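{- Let $R$ be a commutative ring with $2\in R^*$ and $3\neq 0$ in $R$, and let $G\subset R^*$ be a $2$-maximal subgroup. Then: (1) $2\notin G$ and $3\notin G$; (2) if $a+b=2c$ with $a,b,c\in G$, then $a=b=c$; (3) if $a+2b=3c$ with $a,b,c\in G$, then $a=b=c$.
   Context: A subgroup $G\subset R^*$ of the unit group is even if $-1\in G$. An even subgroup $G\subset R^*$ is $2$-maximal if whenever $a-b=2(c-d)$ with $a,b,c,d\in G$, then $a=\pm b$. -}

module Defs where

open import Level using (Level; _⊔_; suc)
open import Algebra.Bundles using (CommutativeRing)
open import Data.Product using (Σ; ∃; _×_; _,_)
open import Data.Sum using (_⊎_)
open import Relation.Nullary using (¬_)

module _ {c ℓ : Level} (R : CommutativeRing c ℓ) where
  open CommutativeRing R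

  two : Carrier
  two = 1# + 1#

  three : Carrier
  three = 1# + 1# + 1#

  IsUnit : Carrier → Set (c ⊔ ℓ)
  IsUnit x = Σ Carrier λ y → x * y ≈ 1#

  record IsUnitSubgroup {p : Level} (G : Carrier → Set p) : Set (c ⊔ ℓ ⊔ p) where
    field
      resp    : ∀ {x y} → x ≈ y → G x → G y
      ⊆units  : ∀ {x} → G x → IsUnit x
      has-1   : G 1#
      *-closed : ∀ {x y} → G x → G y → G (x * y)
      inv-closed : ∀ {x} → G x → Σ Carrier λ y → G y × (x * y ≈ 1#)

  IsEven : {p : Level} → (Carrier → Set p) → Set p
  IsEven G = G (- 1#)

  Is2Maximal : {p : Level} → (Carrier → Set p) → Set (c ⊔ ℓ ⊔ p)
  Is2Maximal G =
    IsEven G ×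
    (∀ a b c d → G a → G b → G c → G d →
      a - b ≈ two * (c - d) → (a ≈ b) ⊎ (a ≈ - b))

{-# OPTIONS --safe #-}
module Submission where

open import Defs
open import Level using (Level)
open import Algebra.Bundles using (CommutativeRing)
open import Data.Product using (_×_; _,_; proj₁; proj₂)
open import Data.Sum using (_⊎_; inj₁; inj₂)
open import Data.Empty using (⊥-elim)
open import Relation.Nullary using (¬_)

-- Every claim comes from one instance of 2-maximality whose two outcomes a ≈ ± b are
-- then refuted or exploited by cancelling the unit 2:
--   2 ∈ G:  2 - 1 = 2 (1 - 2⁻¹), so 2 = ± 1, i.e. 1 = 0 or 3 = 0;
--   3 ∈ G:  3 - (-1) = 2 (1 - (-1)), so 3 = ∓ 1, i.e. 4 = 0 or 2 = 0;
--   a + b = 2c     gives  a - b = 2 (c - b), and a = -b would force 2c = 0;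
--   a + 2b = 3c    gives  a - c = 2 (c - b), and a = -c would force b = 2c, i.e. 2 ∈ G.

module _ {c ℓ : Level} (R : CommutativeRing c ℓ) where
  open CommutativeRing R
  open import Algebra.Properties.Ring ring
  open import Relation.Binary.Reasoning.Setoid setoid

  x-[y+z]≈x-y-z : ∀ x y z → x - (y + z) ≈ x - y - z
  x-[y+z]≈x-y-z x y z = begin
    x + - (y + z)    ≈⟨ +-congˡ (-‿+-comm y z) ⟨
    x + (- y + - z)  ≈⟨ +-assoc x (- y) (- z) ⟨
    x - y - z        ∎

  x+z-[y+z]≈x-y : ∀ x y z → x + z - (y + z) ≈ x - y
  x+z-[y+z]≈x-y x y z = begin
    x + z - (y + z)  ≈⟨ +-congˡ (-‿cong (+-comm y z)) ⟩
    x + z - (z + y)  ≈⟨ x-[y+z]≈x-y-z (x + z) z y ⟩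
    x + z - z - y    ≈⟨ +-congʳ (//-rightDividesʳ z x) ⟩
    x - y            ∎

  x+y≈z⇒x-w≈z-[y+w] : ∀ {x y z} w → x + y ≈ z → x - w ≈ z - (y + w)
  x+y≈z⇒x-w≈z-[y+w] {x} {y} {z} w x+y≈z = begin
    x - w            ≈⟨ +-congʳ (//-rightDividesʳ y x) ⟨
    x + y - y - w    ≈⟨ x-[y+z]≈x-y-z (x + y) y w ⟨
    x + y - (y + w)  ≈⟨ +-congʳ x+y≈z ⟩
    z - (y + w)      ∎

  two*x≈x+x : ∀ x → two R * x ≈ x + x
  two*x≈x+x x = trans (distribʳ x 1# 1#) (+-cong (*-identityˡ x) (*-identityˡ x))

  three*x≈two*x+x : ∀ x → three R * x ≈ two R * x + x
  three*x≈two*x+x x = trans (distribʳ x (two R) 1#) (+-congˡ (*-identityˡ x))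

  three*x+x≈two*[two*x] : ∀ x → three R * x + x ≈ two R * (two R * x)
  three*x+x≈two*[two*x] x = begin
    three R * x + x          ≈⟨ +-congʳ (three*x≈two*x+x x) ⟩
    two R * x + x + x        ≈⟨ +-assoc (two R * x) x x ⟩
    two R * x + (x + x)      ≈⟨ +-congˡ (two*x≈x+x x) ⟨
    two R * x + two R * x    ≈⟨ two*x≈x+x (two R * x) ⟨
    two R * (two R * x)      ∎

  3-[-1]≈2[1-[-1]] : three R - - 1# ≈ two R * (1# - - 1#)
  3-[-1]≈2[1-[-1]] = begin
    three R - - 1#        ≈⟨ +-congˡ (-‿involutive 1#) ⟩
    three R + 1#          ≈⟨ +-congʳ (*-identityʳ (three R)) ⟨
    three R * 1# + 1#     ≈⟨ three*x+x≈two*[two*x] 1# ⟩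
    two R * (two R * 1#)  ≈⟨ *-congˡ (*-identityʳ (two R)) ⟩
    two R * (1# + 1#)     ≈⟨ *-congˡ (+-congˡ (-‿involutive 1#)) ⟨
    two R * (1# - - 1#)   ∎

  ≉0⇒1≉0 : ∀ {x} → x ≉ 0# → 1# ≉ 0#
  ≉0⇒1≉0 {x} x≉0 1≈0 = x≉0 (begin
    x       ≈⟨ *-identityʳ x ⟨
    x * 1#  ≈⟨ *-congˡ 1≈0 ⟩
    x * 0#  ≈⟨ zeroʳ x ⟩
    0#      ∎)

  unit⇒≉0 : 1# ≉ 0# → ∀ {u} → IsUnit R u → u ≉ 0#
  unit⇒≉0 1≉0 {u} (v , uv≈1) u≈0 = 1≉0 (begin
    1#      ≈⟨ uv≈1 ⟨
    u * v   ≈⟨ *-congʳ u≈0 ⟩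
    0# * v  ≈⟨ zeroˡ v ⟩
    0#      ∎)

  unit-cancelˡ : ∀ {u x y} → IsUnit R u → u * x ≈ u * y → x ≈ y
  unit-cancelˡ {u} {x} {y} (v , uv≈1) ux≈uy = begin
    x            ≈⟨ *-identityˡ x ⟨
    1# * x       ≈⟨ *-congʳ vu≈1 ⟨
    v * u * x    ≈⟨ *-assoc v u x ⟩
    v * (u * x)  ≈⟨ *-congˡ ux≈uy ⟩
    v * (u * y)  ≈⟨ *-assoc v u y ⟨
    v * u * y    ≈⟨ *-congʳ vu≈1 ⟩
    1# * y       ≈⟨ *-identityˡ y ⟩
    y            ∎
    where
    vu≈1 : v * u ≈ 1#
    vu≈1 = trans (*-comm v u) uv≈1

  module _ {p : Level} {G : Carrier → Set p} (G-subgroup : IsUnitSubgroup R G) where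
    open IsUnitSubgroup G-subgroup

    ∈-cancelʳ : ∀ {x y} → G y → G (x * y) → G x
    ∈-cancelʳ {x} {y} y∈G xy∈G with inv-closed y∈G
    ... | z , z∈G , yz≈1 = resp xyz≈x (*-closed xy∈G z∈G)
      where
      xyz≈x : x * y * z ≈ x
      xyz≈x = begin
        x * y * z    ≈⟨ *-assoc x y z ⟩
        x * (y * z)  ≈⟨ *-congˡ yz≈1 ⟩
        x * 1#       ≈⟨ *-identityʳ x ⟩
        x            ∎

  module TwoMaximal (two-unit : IsUnit R (two R)) (three≉0 : three R ≉ 0#)
           {p : Level} {G : Carrier → Set p}
           (G-subgroup : IsUnitSubgroup R G) (G-2-maximal : Is2Maximal R G) where
    open IsUnitSubgroup G-subgroup

    1≉0 : 1# ≉ 0#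
    1≉0 = ≉0⇒1≉0 three≉0

    two≉0 : two R ≉ 0#
    two≉0 = unit⇒≉0 1≉0 two-unit

    two-cancelˡ : ∀ {x y} → two R * x ≈ two R * y → x ≈ y
    two-cancelˡ = unit-cancelˡ two-unit

    two*x≈0⇒x≈0 : ∀ {x} → two R * x ≈ 0# → x ≈ 0#
    two*x≈0⇒x≈0 {x} 2x≈0 = two-cancelˡ (trans 2x≈0 (sym (zeroʳ (two R))))

    -1∈G : G (- 1#)
    -1∈G = proj₁ G-2-maximal

    ≈± : ∀ {a b c d} → G a → G b → G c → G d → a - b ≈ two R * (c - d) → a ≈ b ⊎ a ≈ - b
    ≈± {a} {b} {c} {d} = proj₂ G-2-maximal a b c d

    two∉G : ¬ G (two R)
    two∉G 2∈G with inv-closed 2∈G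
    ... | h , h∈G , 2h≈1 with ≈± 2∈G has-1 has-1 h∈G 2-1≈2[1-h]
      where
      2-1≈2[1-h] : two R - 1# ≈ two R * (1# - h)
      2-1≈2[1-h] = sym (trans (x[y-z]≈xy-xz (two R) 1# h) (+-cong (*-identityʳ (two R)) (-‿cong 2h≈1)))
    ... | inj₁ 2≈1  = 1≉0 (x+x≈x⇒x≈0 1# 2≈1)
    ... | inj₂ 2≈-1 = three≉0 (trans (+-congʳ 2≈-1) (-‿inverseˡ 1#))

    three∉G : ¬ G (three R)
    three∉G 3∈G with ≈± 3∈G -1∈G has-1 -1∈G 3-[-1]≈2[1-[-1]]
    ... | inj₁ 3≈-1 = two≉0 (begin
        two R        ≈⟨ +-congˡ (-‿involutive 1#) ⟨
        1# - - 1#    ≈⟨ two*x≈0⇒x≈0 (begin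
          two R * (1# - - 1#)  ≈⟨ 3-[-1]≈2[1-[-1]] ⟨
          three R - - 1#       ≈⟨ +-congʳ 3≈-1 ⟩
          - 1# - - 1#          ≈⟨ -‿inverseʳ (- 1#) ⟩
          0#                   ∎) ⟩
        0#           ∎)
    ... | inj₂ 3≈--1 = two≉0 (+-cancelʳ 1# (two R) 0# (begin
        three R      ≈⟨ 3≈--1 ⟩
        - - 1#       ≈⟨ -‿involutive 1# ⟩
        1#           ≈⟨ +-identityˡ 1# ⟨
        0# + 1#      ∎))

    a+b≈2c⇒a≈b≈c : ∀ a b c → G a → G b → G c → a + b ≈ two R * c → a ≈ b × b ≈ c
    a+b≈2c⇒a≈b≈c a b c a∈G b∈G c∈G a+b≈2c with ≈± a∈G b∈G c∈G b∈G a-b≈2[c-b]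
      where
      a-b≈2[c-b] : a - b ≈ two R * (c - b)
      a-b≈2[c-b] = begin
        a - b                  ≈⟨ x+y≈z⇒x-w≈z-[y+w] b a+b≈2c ⟩
        two R * c - (b + b)    ≈⟨ +-congˡ (-‿cong (two*x≈x+x b)) ⟨
        two R * c - two R * b  ≈⟨ x[y-z]≈xy-xz (two R) c b ⟨
        two R * (c - b)        ∎
    ... | inj₁ a≈b  = a≈b , two-cancelˡ (begin
        two R * b    ≈⟨ two*x≈x+x b ⟩
        b + b        ≈⟨ +-congʳ a≈b ⟨
        a + b        ≈⟨ a+b≈2c ⟩
        two R * c    ∎)
    ... | inj₂ a≈-b = ⊥-elim (unit⇒≉0 1≉0 (⊆units c∈G) (two*x≈0⇒x≈0 (begin
        two R * c    ≈⟨ a+b≈2c ⟨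
        a + b        ≈⟨ +-congʳ a≈-b ⟩
        - b + b      ≈⟨ -‿inverseˡ b ⟩
        0#           ∎)))

    a+2b≈3c⇒a≈b≈c : ∀ a b c → G a → G b → G c → a + two R * b ≈ three R * c → a ≈ b × b ≈ c
    a+2b≈3c⇒a≈b≈c a b c a∈G b∈G c∈G a+2b≈3c with ≈± a∈G c∈G c∈G b∈G a-c≈2[c-b]
      where
      a-c≈2[c-b] : a - c ≈ two R * (c - b)
      a-c≈2[c-b] = begin
        a - c                            ≈⟨ x+y≈z⇒x-w≈z-[y+w] c a+2b≈3c ⟩
        three R * c - (two R * b + c)    ≈⟨ +-congʳ (three*x≈two*x+x c) ⟩
        two R * c + c - (two R * b + c)  ≈⟨ x+z-[y+z]≈x-y (two R * c) (two R * b) c ⟩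
        two R * c - two R * b            ≈⟨ x[y-z]≈xy-xz (two R) c b ⟨
        two R * (c - b)                  ∎
    ... | inj₁ a≈c  = trans a≈c (sym b≈c) , b≈c
      where
      b≈c : b ≈ c
      b≈c = two-cancelˡ (+-cancelˡ c (two R * b) (two R * c) (begin
        c + two R * b    ≈⟨ +-congʳ a≈c ⟨
        a + two R * b    ≈⟨ a+2b≈3c ⟩
        three R * c      ≈⟨ three*x≈two*x+x c ⟩
        two R * c + c    ≈⟨ +-comm (two R * c) c ⟩
        c + two R * c    ∎))
    ... | inj₂ a≈-c = ⊥-elim (two∉G (∈-cancelʳ G-subgroup c∈G (resp b≈2c b∈G)))
      where
      b≈2c : b ≈ two R * c
      b≈2c = two-cancelˡ (begin
        two R * b              ≈⟨ y≈x\\z a (two R * b) (three R * c) a+2b≈3c ⟩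
        - a + three R * c      ≈⟨ +-congʳ (trans (-‿cong a≈-c) (-‿involutive c)) ⟩
        c + three R * c        ≈⟨ +-comm c (three R * c) ⟩
        three R * c + c        ≈⟨ three*x+x≈two*[two*x] c ⟩
        two R * (two R * c)    ∎)

proposition4p1 : {c ℓ p : Level} (R : CommutativeRing c ℓ) →
    let open CommutativeRing R in
    IsUnit R (two R) → ¬ (three R ≈ 0#) →
    (G : Carrier → Set p) → IsUnitSubgroup R G → Is2Maximal R G →
    ((¬ G (two R)) × (¬ G (three R)))
    × (∀ a b c → G a → G b → G c → a + b ≈ two R * c → (a ≈ b) × (b ≈ c))
    × (∀ a b c → G a → G b → G c → a + two R * b ≈ three R * c → (a ≈ b) × (b ≈ c))
proposition4p1 R two-unit three≉0 G G-subgroup G-2-maximal =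
  (two∉G , three∉G) , a+b≈2c⇒a≈b≈c , a+2b≈3c⇒a≈b≈c
  where open TwoMaximal R two-unit three≉0 G-subgroup G-2-maximal
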